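{- Let $n\in\mathbb{N}_0$ and define $$y\left(n,\tfrac12\right)=\sum_{j=0}^{n}\frac{(-1)^{n}}{(j+1)\left(\tfrac12\right)^{j+1}\left(\tfrac12-1\right)^{n+1-j}}.$$ Then $$y\left(n,\tfrac12\right)=2^{n+2}\left(H_{\lfloor n/2\rfloor}-H_n+\frac{(-1)^{n+1}}{n+1}\right),$$ where $H_m=\sum_{k=1}^m\frac1k$ denotes the $m$-th harmonic number, with $H_0=0$, and $\lfloor\cdot\rfloor$ is the integer part. -}

module Defs where

open import Data.Nat as ℕ using (ℕ; zero; suc)
open import Data.Integer using (+_)
open import Data.Rational using (ℚ; 0ℚ; 1ℚ; _+_; _*_; _-_; -_; _÷_; _/_; ≢-nonZero)
open import Data.Rational.Properties using (_≟_)
open import Relation.Nullary using (yes; no)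

_^_ : ℚ → ℕ → ℚ
x ^ zero  = 1ℚ
x ^ suc n = x * (x ^ n)

ℕtoℚ : ℕ → ℚ
ℕtoℚ n = + n / 1

-- division p / q (q is always nonzero where used; we return 0 for q = 0)
_÷'_ : ℚ → ℚ → ℚ
p ÷' q with q ≟ 0ℚ
... | yes _  = 0ℚ
... | no q≢0 = _÷_ p q {{≢-nonZero q≢0}}

sumTo : ℕ → (ℕ → ℚ) → ℚ
sumTo zero    f = f 0
sumTo (suc n) f = sumTo n f + f (suc n)

H : ℕ → ℚ
H zero    = 0ℚ
H (suc m) = H m + (+ 1 / suc m)

y : ℕ → ℚ → ℚ
y n x = sumTo n (λ j →
  ((- 1ℚ) ^ n) ÷' (ℕtoℚ (suc j) * (x ^ suc j) * ((x - 1ℚ) ^ (suc n ℕ.∸ j))))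

-- Since ½ - 1 = -½, the j-th summand of y(n, ½) is 2^(n+2) (-1)^(j+1) / (j+1), so
-- y(n, ½) is 2^(n+2) times the alternating harmonic sum A(n+1), where A(N) = Σ_{k=1}^N (-1)^k / k.
-- Pairing consecutive terms, -1/(2m+1) + 1/(2m+2) = 1/(m+1) - 1/(2m+1) - 1/(2m+2), gives
-- A(2m) = H_m - H_{2m}, hence A(N) = H_⌊N/2⌋ - H_N for every N; finally A(n+1) = A(n) + (-1)^(n+1)/(n+1).
module Submission where

open import Defs
open import Data.Nat as ℕ using (ℕ; zero; suc; _/_; _%_; _<_)
open import Data.Nat.DivMod using (m≡m%n+[m/n]*n; m%n<n)
import Data.Nat.Properties as ℕ
open import Data.Integer as ℤ using (+_)
import Data.Integer.Properties as ℤ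
open import Data.Rational as ℚ using (ℚ; ½; 0ℚ; 1ℚ; _+_; _*_; _-_; -_; 1/_; toℚᵘ; ≢-nonZero)
open import Data.Rational.Properties
  using (_≟_; toℚᵘ-injective; toℚᵘ-fromℚᵘ; toℚᵘ-homo-+; toℚᵘ-homo-*;
         *-zeroˡ; *-zeroʳ; *-identityˡ; *-identityʳ; *-assoc; *-inverseʳ; *-distribˡ-+; +-identityˡ)
import Data.Rational.Unnormalised as ℚᵘ
import Data.Rational.Unnormalised.Properties as ℚᵘ
open import Data.Rational.Solver using (module +-*-Solver)
open import Relation.Binary.PropositionalEquality
  using (_≡_; _≢_; refl; sym; trans; cong; cong₂; subst; module ≡-Reasoning)
open import Relation.Nullary using (yes; no)
open import Data.Empty using (⊥-elim)

open +-*-Solver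

1/[1+_] : ℕ → ℚ
1/[1+ m ] = + 1 ℚ./ suc m

toℚᵘ-ℕtoℚ : ∀ n → toℚᵘ (ℕtoℚ n) ℚᵘ.≃ ℚᵘ.mkℚᵘ (+ n) 0
toℚᵘ-ℕtoℚ n = toℚᵘ-fromℚᵘ (ℚᵘ.mkℚᵘ (+ n) 0)

ℕtoℚ-+ : ∀ a b → ℕtoℚ (a ℕ.+ b) ≡ ℕtoℚ a + ℕtoℚ b
ℕtoℚ-+ a b = toℚᵘ-injective (begin-equality
  toℚᵘ (ℕtoℚ (a ℕ.+ b))                    ≃⟨ toℚᵘ-ℕtoℚ (a ℕ.+ b) ⟩
  ℚᵘ.mkℚᵘ (+ (a ℕ.+ b)) 0                  ≃⟨ ℚᵘ.*≡* (cong (ℤ._* + 1) pos-+′) ⟩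
  ℚᵘ.mkℚᵘ (+ a) 0 ℚᵘ.+ ℚᵘ.mkℚᵘ (+ b) 0     ≃⟨ ℚᵘ.+-cong (toℚᵘ-ℕtoℚ a) (toℚᵘ-ℕtoℚ b) ⟨
  toℚᵘ (ℕtoℚ a) ℚᵘ.+ toℚᵘ (ℕtoℚ b)         ≃⟨ toℚᵘ-homo-+ (ℕtoℚ a) (ℕtoℚ b) ⟨
  toℚᵘ (ℕtoℚ a + ℕtoℚ b)                   ∎)
  where
  open ℚᵘ.≤-Reasoning
  pos-+′ : + (a ℕ.+ b) ≡ + a ℤ.* + 1 ℤ.+ + b ℤ.* + 1
  pos-+′ = trans (ℤ.pos-+ a b) (sym (cong₂ ℤ._+_ (ℤ.*-identityʳ (+ a)) (ℤ.*-identityʳ (+ b))))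

ℕtoℚ-* : ∀ a b → ℕtoℚ (a ℕ.* b) ≡ ℕtoℚ a * ℕtoℚ b
ℕtoℚ-* a b = toℚᵘ-injective (begin-equality
  toℚᵘ (ℕtoℚ (a ℕ.* b))                    ≃⟨ toℚᵘ-ℕtoℚ (a ℕ.* b) ⟩
  ℚᵘ.mkℚᵘ (+ (a ℕ.* b)) 0                  ≃⟨ ℚᵘ.*≡* (cong (ℤ._* + 1) (ℤ.pos-* a b)) ⟩
  ℚᵘ.mkℚᵘ (+ a) 0 ℚᵘ.* ℚᵘ.mkℚᵘ (+ b) 0     ≃⟨ ℚᵘ.*-cong (toℚᵘ-ℕtoℚ a) (toℚᵘ-ℕtoℚ b) ⟨
  toℚᵘ (ℕtoℚ a) ℚᵘ.* toℚᵘ (ℕtoℚ b)         ≃⟨ toℚᵘ-homo-* (ℕtoℚ a) (ℕtoℚ b) ⟨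
  toℚᵘ (ℕtoℚ a * ℕtoℚ b)                   ∎)
  where open ℚᵘ.≤-Reasoning

-- In ℚᵘ, 1/[1+ m ] is literally ℚᵘ.1/ of 1 + m.
1/[1+m]*[1+m]≡1 : ∀ m → 1/[1+ m ] * ℕtoℚ (suc m) ≡ 1ℚ
1/[1+m]*[1+m]≡1 m = toℚᵘ-injective (begin-equality
  toℚᵘ (1/[1+ m ] * ℕtoℚ (suc m))             ≃⟨ toℚᵘ-homo-* 1/[1+ m ] (ℕtoℚ (suc m)) ⟩
  toℚᵘ 1/[1+ m ] ℚᵘ.* toℚᵘ (ℕtoℚ (suc m))     ≃⟨ ℚᵘ.*-cong (toℚᵘ-fromℚᵘ (ℚᵘ.mkℚᵘ (+ 1) m)) (toℚᵘ-ℕtoℚ (suc m)) ⟩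
  ℚᵘ.1/ N ℚᵘ.* N                              ≃⟨ ℚᵘ.*-inverseˡ N ⟩
  ℚᵘ.1ℚᵘ                                      ∎)
  where
  open ℚᵘ.≤-Reasoning
  N = ℚᵘ.mkℚᵘ (+ suc m) 0

open ≡-Reasoning

*-inverse-unique : ∀ x y z → x * z ≡ 1ℚ → y * z ≡ 1ℚ → x ≡ y
*-inverse-unique x y z xz≡1 yz≡1 = begin
  x             ≡⟨ *-identityʳ x ⟨
  x * 1ℚ        ≡⟨ cong (x *_) yz≡1 ⟨
  x * (y * z)   ≡⟨ solve 3 (λ x y z → x :* (y :* z) := y :* (x :* z)) refl x y z ⟩
  y * (x * z)   ≡⟨ cong (y *_) xz≡1 ⟩
  y * 1ℚ        ≡⟨ *-identityʳ y ⟩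
  y             ∎

1/[1+]-double : ∀ m → 1/[1+ suc (m ℕ.* 2) ] + 1/[1+ suc (m ℕ.* 2) ] ≡ 1/[1+ m ]
1/[1+]-double m = *-inverse-unique _ _ (ℕtoℚ (suc m)) (begin
  (r + r) * N            ≡⟨ solve 2 (λ r N → (r :+ r) :* N := r :* (N :* con (ℕtoℚ 2))) refl r N ⟩
  r * (N * ℕtoℚ 2)       ≡⟨ cong (r *_) (ℕtoℚ-* (suc m) 2) ⟨
  r * ℕtoℚ (suc m ℕ.* 2) ≡⟨ 1/[1+m]*[1+m]≡1 (suc (m ℕ.* 2)) ⟩
  1ℚ                     ∎) (1/[1+m]*[1+m]≡1 m)
  where
  r = 1/[1+ suc (m ℕ.* 2) ]
  N = ℕtoℚ (suc m)

*≡1⇒≢0 : ∀ x y → x * y ≡ 1ℚ → x ≢ 0ℚ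
*≡1⇒≢0 x y xy≡1 refl with trans (sym xy≡1) (*-zeroˡ y)
... | ()

÷'-unique : ∀ p q r → p ≢ 0ℚ → r * q ≡ p → p ÷' q ≡ r
÷'-unique p q r p≢0 rq≡p with q ≟ 0ℚ
... | yes refl = ⊥-elim (p≢0 (trans (sym rq≡p) (*-zeroʳ r)))
... | no q≢0 = begin
  p * 1/ q         ≡⟨ cong (_* 1/ q) rq≡p ⟨
  r * q * 1/ q     ≡⟨ *-assoc r q (1/ q) ⟩
  r * (q * 1/ q)   ≡⟨ cong (r *_) (*-inverseʳ q) ⟩
  r * 1ℚ           ≡⟨ *-identityʳ r ⟩
  r                ∎
  where instance _ = ≢-nonZero q≢0

^-distribˡ-+-* : ∀ x a b → x ^ (a ℕ.+ b) ≡ x ^ a * x ^ b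
^-distribˡ-+-* x zero    b = sym (*-identityˡ (x ^ b))
^-distribˡ-+-* x (suc a) b = trans (cong (x *_) (^-distribˡ-+-* x a b)) (sym (*-assoc x (x ^ a) (x ^ b)))

^-distribʳ-* : ∀ x y k → (x * y) ^ k ≡ x ^ k * y ^ k
^-distribʳ-* x y zero    = refl
^-distribʳ-* x y (suc k) = trans (cong ((x * y) *_) (^-distribʳ-* x y k))
  (solve 4 (λ x y u v → (x :* y) :* (u :* v) := (x :* u) :* (y :* v)) refl x y (x ^ k) (y ^ k))

½^k*2^k≡1 : ∀ k → ½ ^ k * ℕtoℚ (2 ℕ.^ k) ≡ 1ℚ
½^k*2^k≡1 zero    = refl
½^k*2^k≡1 (suc k) = begin
  ½ * ½ ^ k * ℕtoℚ (2 ℕ.* 2 ℕ.^ k)          ≡⟨ cong (½ * ½ ^ k *_) (ℕtoℚ-* 2 (2 ℕ.^ k)) ⟩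
  ½ * ½ ^ k * (ℕtoℚ 2 * ℕtoℚ (2 ℕ.^ k))    ≡⟨ solve 2 (λ u v → con ½ :* u :* (con (ℕtoℚ 2) :* v) := con (½ * ℕtoℚ 2) :* (u :* v))
                                                  refl (½ ^ k) (ℕtoℚ (2 ℕ.^ k)) ⟩
  ½ * ℕtoℚ 2 * (½ ^ k * ℕtoℚ (2 ℕ.^ k))    ≡⟨ cong (½ * ℕtoℚ 2 *_) (½^k*2^k≡1 k) ⟩
  1ℚ                                        ∎

-1ℚ : ℚ
-1ℚ = - 1ℚ

-1^n*-1^n≡1 : ∀ n → -1ℚ ^ n * -1ℚ ^ n ≡ 1ℚ
-1^n*-1^n≡1 zero    = refl
-1^n*-1^n≡1 (suc n) = trans (solve 1 (λ u → (con -1ℚ :* u) :* (con -1ℚ :* u) := u :* u) refl (-1ℚ ^ n)) (-1^n*-1^n≡1 n)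

-1^n≢0 : ∀ n → -1ℚ ^ n ≢ 0ℚ
-1^n≢0 n = *≡1⇒≢0 _ _ (-1^n*-1^n≡1 n)

-1^[m*2]≡1 : ∀ m → -1ℚ ^ (m ℕ.* 2) ≡ 1ℚ
-1^[m*2]≡1 zero    = refl
-1^[m*2]≡1 (suc m) = trans (sym (*-assoc -1ℚ -1ℚ (-1ℚ ^ (m ℕ.* 2)))) (trans (*-identityˡ (-1ℚ ^ (m ℕ.* 2))) (-1^[m*2]≡1 m))

-1^[n+2]≡-1^n : ∀ n → -1ℚ ^ (n ℕ.+ 2) ≡ -1ℚ ^ n
-1^[n+2]≡-1^n n = trans (^-distribˡ-+-* -1ℚ n 2) (*-identityʳ (-1ℚ ^ n))

sumTo-cong : ∀ n {f g : ℕ → ℚ} → (∀ j → j ℕ.≤ n → f j ≡ g j) → sumTo n f ≡ sumTo n g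
sumTo-cong zero    f≗g = f≗g 0 ℕ.z≤n
sumTo-cong (suc n) f≗g = cong₂ _+_ (sumTo-cong n (λ j j≤n → f≗g j (ℕ.m≤n⇒m≤1+n j≤n))) (f≗g (suc n) ℕ.≤-refl)

sumTo-distribˡ : ∀ n k (f : ℕ → ℚ) → k * sumTo n f ≡ sumTo n (λ j → k * f j)
sumTo-distribˡ zero    k f = refl
sumTo-distribˡ (suc n) k f = trans (*-distribˡ-+ k _ _) (cong (_+ k * f (suc n)) (sumTo-distribˡ n k f))

alternatingTerm : ℕ → ℚ
alternatingTerm j = -1ℚ ^ suc j * 1/[1+ j ]

alternatingH : ℕ → ℚ
alternatingH zero    = 0ℚ
alternatingH (suc N) = alternatingH N + alternatingTerm N

sumTo-alternatingTerm : ∀ n → sumTo n alternatingTerm ≡ alternatingH (suc n)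
sumTo-alternatingTerm zero    = sym (+-identityˡ (alternatingTerm 0))
sumTo-alternatingTerm (suc n) = cong (_+ alternatingTerm (suc n)) (sumTo-alternatingTerm n)

alternatingH-even : ∀ m → alternatingH (m ℕ.* 2) ≡ H m - H (m ℕ.* 2)
alternatingH-even zero    = refl
alternatingH-even (suc m) = begin
  alternatingH (m ℕ.* 2) + alternatingTerm (m ℕ.* 2) + alternatingTerm (suc (m ℕ.* 2))
    ≡⟨ cong (λ a → a + alternatingTerm (m ℕ.* 2) + alternatingTerm (suc (m ℕ.* 2))) (alternatingH-even m) ⟩
  H m - H (m ℕ.* 2) + -1ℚ * s * r₁ + -1ℚ * (-1ℚ * s) * r₂
    ≡⟨ cong (λ s → H m - H (m ℕ.* 2) + -1ℚ * s * r₁ + -1ℚ * (-1ℚ * s) * r₂) (-1^[m*2]≡1 m) ⟩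
  H m - H (m ℕ.* 2) + -1ℚ * 1ℚ * r₁ + -1ℚ * (-1ℚ * 1ℚ) * r₂
    ≡⟨ solve 4 (λ a b r₁ r₂ → a :- b :+ con -1ℚ :* con 1ℚ :* r₁ :+ con -1ℚ :* (con -1ℚ :* con 1ℚ) :* r₂
                              := a :+ (r₂ :+ r₂) :- (b :+ r₁ :+ r₂))
         refl (H m) (H (m ℕ.* 2)) r₁ r₂ ⟩
  H m + (r₂ + r₂) - (H (m ℕ.* 2) + r₁ + r₂)
    ≡⟨ cong (λ r → H m + r - (H (m ℕ.* 2) + r₁ + r₂)) (1/[1+]-double m) ⟩
  H m + 1/[1+ m ] - (H (m ℕ.* 2) + r₁ + r₂) ∎
  where
  s  = -1ℚ ^ (m ℕ.* 2)
  r₁ = 1/[1+ m ℕ.* 2 ]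
  r₂ = 1/[1+ suc (m ℕ.* 2) ]

alternatingH-odd : ∀ m → alternatingH (suc (m ℕ.* 2)) ≡ H m - H (suc (m ℕ.* 2))
alternatingH-odd m = begin
  alternatingH (m ℕ.* 2) + -1ℚ * -1ℚ ^ (m ℕ.* 2) * r
    ≡⟨ cong₂ (λ a s → a + -1ℚ * s * r) (alternatingH-even m) (-1^[m*2]≡1 m) ⟩
  H m - H (m ℕ.* 2) + -1ℚ * 1ℚ * r
    ≡⟨ solve 3 (λ a b r → a :- b :+ con -1ℚ :* con 1ℚ :* r := a :- (b :+ r)) refl (H m) (H (m ℕ.* 2)) r ⟩
  H m - (H (m ℕ.* 2) + r) ∎
  where r = 1/[1+ m ℕ.* 2 ]

alternatingH≡H[N/2]-H[N] : ∀ N → alternatingH N ≡ H (N / 2) - H N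
alternatingH≡H[N/2]-H[N] N =
  subst (λ k → alternatingH k ≡ H (N / 2) - H k) (sym (m≡m%n+[m/n]*n N 2)) (byRemainder (N % 2) (m%n<n N 2))
  where
  byRemainder : ∀ r → r < 2 → alternatingH (r ℕ.+ N / 2 ℕ.* 2) ≡ H (N / 2) - H (r ℕ.+ N / 2 ℕ.* 2)
  byRemainder 0 _ = alternatingH-even (N / 2)
  byRemainder 1 _ = alternatingH-odd (N / 2)
  byRemainder (suc (suc _)) (ℕ.s≤s (ℕ.s≤s ()))

alternatingTerm≡÷' : ∀ j → (-1ℚ ^ suc j) ÷' ℕtoℚ (suc j) ≡ alternatingTerm j
alternatingTerm≡÷' j = ÷'-unique _ _ _ (-1^n≢0 (suc j)) (begin
  -1ℚ ^ suc j * 1/[1+ j ] * ℕtoℚ (suc j)    ≡⟨ *-assoc (-1ℚ ^ suc j) 1/[1+ j ] (ℕtoℚ (suc j)) ⟩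
  -1ℚ ^ suc j * (1/[1+ j ] * ℕtoℚ (suc j))  ≡⟨ cong (-1ℚ ^ suc j *_) (1/[1+m]*[1+m]≡1 j) ⟩
  -1ℚ ^ suc j * 1ℚ                          ≡⟨ *-identityʳ (-1ℚ ^ suc j) ⟩
  -1ℚ ^ suc j                               ∎)

y-summand-½ : ∀ n j → j ℕ.≤ n →
  (-1ℚ ^ n) ÷' (ℕtoℚ (suc j) * ½ ^ suc j * (½ - 1ℚ) ^ (suc n ℕ.∸ j)) ≡ ℕtoℚ (2 ℕ.^ (n ℕ.+ 2)) * alternatingTerm j
y-summand-½ n j j≤n = ÷'-unique _ _ _ (-1^n≢0 n) (begin
  K * (σ₁ * r) * (N * h₁ * (-1ℚ * ½) ^ e)   ≡⟨ cong (λ u → K * (σ₁ * r) * (N * h₁ * u)) (^-distribʳ-* -1ℚ ½ e) ⟩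
  K * (σ₁ * r) * (N * h₁ * (σ₂ * h₂))       ≡⟨ solve 7 (λ K σ₁ r N h₁ σ₂ h₂ → K :* (σ₁ :* r) :* (N :* h₁ :* (σ₂ :* h₂))
                                                           := r :* N :* (σ₁ :* σ₂) :* (h₁ :* h₂ :* K))
                                                  refl K σ₁ r N h₁ σ₂ h₂ ⟩
  r * N * (σ₁ * σ₂) * (h₁ * h₂ * K)         ≡⟨ cong₂ (λ u v → u * v * (h₁ * h₂ * K))
                                                   (1/[1+m]*[1+m]≡1 j) (sym (^-distribˡ-+-* -1ℚ (suc j) e)) ⟩
  1ℚ * -1ℚ ^ (suc j ℕ.+ e) * (h₁ * h₂ * K)  ≡⟨ cong (λ u → 1ℚ * -1ℚ ^ (suc j ℕ.+ e) * (u * K)) (^-distribˡ-+-* ½ (suc j) e) ⟨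
  1ℚ * -1ℚ ^ (suc j ℕ.+ e) * (½ ^ (suc j ℕ.+ e) * K)
                                            ≡⟨ cong (λ t → 1ℚ * -1ℚ ^ t * (½ ^ t * K)) exponents ⟩
  1ℚ * -1ℚ ^ (n ℕ.+ 2) * (½ ^ (n ℕ.+ 2) * K) ≡⟨ cong₂ (λ u v → 1ℚ * u * v) (-1^[n+2]≡-1^n n) (½^k*2^k≡1 (n ℕ.+ 2)) ⟩
  1ℚ * -1ℚ ^ n * 1ℚ                          ≡⟨ trans (*-identityʳ _) (*-identityˡ _) ⟩
  -1ℚ ^ n                                    ∎)
  where
  K  = ℕtoℚ (2 ℕ.^ (n ℕ.+ 2))
  N  = ℕtoℚ (suc j)
  r  = 1/[1+ j ]
  e  = suc n ℕ.∸ j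
  σ₁ = -1ℚ ^ suc j
  σ₂ = -1ℚ ^ e
  h₁ = ½ ^ suc j
  h₂ = ½ ^ e
  exponents : suc j ℕ.+ e ≡ n ℕ.+ 2
  exponents = trans (cong suc (ℕ.m+[n∸m]≡n (ℕ.m≤n⇒m≤1+n j≤n))) (ℕ.+-comm 2 n)

theorem3 : (n : ℕ) →
    y n ½ ≡ ℕtoℚ (2 ℕ.^ (n ℕ.+ 2)) * (H (n / 2) - H n + (((- 1ℚ) ^ suc n) ÷' ℕtoℚ (suc n)))
theorem3 n = begin
  y n ½                                          ≡⟨ sumTo-cong n (y-summand-½ n) ⟩
  sumTo n (λ j → K * alternatingTerm j)          ≡⟨ sumTo-distribˡ n K alternatingTerm ⟨
  K * sumTo n alternatingTerm                    ≡⟨ cong (K *_) (sumTo-alternatingTerm n) ⟩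
  K * (alternatingH n + alternatingTerm n)       ≡⟨ cong (λ a → K * (a + alternatingTerm n)) (alternatingH≡H[N/2]-H[N] n) ⟩
  K * (H (n / 2) - H n + alternatingTerm n)      ≡⟨ cong (λ t → K * (H (n / 2) - H n + t)) (alternatingTerm≡÷' n) ⟨
  K * (H (n / 2) - H n + (-1ℚ ^ suc n) ÷' ℕtoℚ (suc n)) ∎
  where K = ℕtoℚ (2 ℕ.^ (n ℕ.+ 2))
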